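{- $FV(s\circ\lambda\Delta.M)=FV(\lambda\Delta.\Uparrow_\Delta\!(s)\circ M)$.
   Context: $\lambda\pi$ terms $M::= a\mid MN\mid\lambda a.M\mid s\circ M$, substitutions $s::= id\mid\pi_a\mid\langle s\,,\,N\backslash a\rangle\mid s\circ q$; $\Delta$ is a list of variables. $\lambda\,nil.M\equiv M$, $\lambda\Sigma,a.M\equiv\lambda\Sigma.(\lambda a.M)$; $\Uparrow_{nil}(s)\equiv s$, $\Uparrow_{\Sigma,a}(s)\equiv\langle\pi_a\circ\Uparrow_\Sigma(s)\,,\,a\backslash a\rangle$. $FV(M)=\langle FV_1(M),FV_2(M),\ldots\rangle$: $FV(a)=\langle\{a\},\emptyset,\ldots\rangle$, $FV(MN)=FV(M)\cup FV(N)$, $FV(\lambda a.M)=O_{\lambda a}(FV(M))$, $FV(s\circ M)=O_s(FV(M))$, where $O_{\lambda a}(\mathcal A)=\langle(\mathcal A_1\setminus\{a\})\cup\mathcal A_2,\mathcal A_3,\ldots\rangle$, $O_{id}(\mathcal A)=\mathcal A$, $O_{\pi_a}(\mathcal A)=\langle\emptyset,\mathcal A_1,\mathcal A_2,\ldots\rangle$, $O_{s\circ q}(\mathcal A)=O_s(O_q(\mathcal A))$, $O_{\langle s,N\backslash a\rangle}(\mathcal A)=O_s(O_{\lambda a}(\mathcal A))\cup FV(N)$. -}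

module Defs where

open import Data.Nat using (ℕ; zero; suc; _≡ᵇ_)
open import Data.Bool using (Bool; true; false; _∧_; _∨_; not)

Var : Set
Var = ℕ

mutual
  data Term : Set where
    var  : Var → Term
    app  : Term → Term → Term
    lam  : Var → Term → Term
    _∘ₜ_ : Subst → Term → Term

  data Subst : Set where
    idₛ  : Subst
    π    : Var → Subst
    ⟨_,_╲_⟩ : Subst → Term → Var → Subst
    _∘ₛ_ : Subst → Subst → Subst

infixr 5 _∘ₜ_ _∘ₛ_

-- Δ : lists of variables, built by snoc (Σ , a), as in λ(Σ,a).M ≡ λΣ.(λa.M).
data Ctx : Set where
  nil : Ctx
  _,_ : Ctx → Var → Ctx

lams : Ctx → Term → Term
lams nil     M = M
lams (Σ , a) M = lams Σ (lam a M)

⇑ : Ctx → Subst → Subst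
⇑ nil     s = s
⇑ (Σ , a) s = ⟨ π a ∘ₛ ⇑ Σ s , var a ╲ a ⟩

VarSet : Set
VarSet = Var → Bool

-- A sequence ⟨A₁, A₂, …⟩ of variable sets; index 0 is A₁.
FVSeq : Set
FVSeq = ℕ → VarSet

∅ : VarSet
∅ _ = false

_∪_ : FVSeq → FVSeq → FVSeq
(A ∪ B) n x = A n x ∨ B n x

single : Var → FVSeq
single a zero    x = x ≡ᵇ a
single a (suc n) x = false

Oλ : Var → FVSeq → FVSeq
Oλ a A zero    x = (A 0 x ∧ not (x ≡ᵇ a)) ∨ A 1 x
Oλ a A (suc n) x = A (suc (suc n)) x

Oπ : FVSeq → FVSeq
Oπ A zero    = ∅
Oπ A (suc n) = A n

mutual
  FV : Term → FVSeq
  FV (var a)   = single a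
  FV (app M N) = FV M ∪ FV N
  FV (lam a M) = Oλ a (FV M)
  FV (s ∘ₜ M)  = O s (FV M)

  O : Subst → FVSeq → FVSeq
  O idₛ            A = A
  O (π a)          A = Oπ A
  O (s ∘ₛ q)       A = O s (O q A)
  O ⟨ s , N ╲ a ⟩ A = O s (Oλ a A) ∪ FV N

module Submission where

-- FV is compositional, so both sides are computed from FV M by operators on
-- sequences of variable sets.  Writing Oλs Δ for the iterated abstraction
-- operator (so that FV (λΔ.M) = Oλs Δ (FV M)), the theorem becomes the
-- operator identity  O s ∘ Oλs Δ = Oλs Δ ∘ O (⇑ Δ s), proved by induction on Δ.
-- The inductive step rests on one computation for a single binder a:
-- abstracting a after applying ⇑_{Σ,a}(s) = ⟨π_a ∘ ⇑_Σ(s), a\a⟩ gives the same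
-- sequence as applying ⇑_Σ(s) after abstracting a, because O_{π_a} shifts every
-- level up by one, the component a\a only adds a at level 1, and O_{λa} removes
-- exactly that a while shifting the levels back down.  Since the identities
-- hold only pointwise, we work with pointwise equality ≈ of sequences and use
-- that the abstraction operators respect it.

open import Defs
open import Data.Nat using (ℕ; zero; suc; _≡ᵇ_)
open import Data.Bool using (false; _∧_; _∨_; not)
open import Data.Bool.Properties using (∨-identityʳ; ∧-inverseʳ)
open import Relation.Binary.PropositionalEquality
open ≡-Reasoning

_≈_ : FVSeq → FVSeq → Set
A ≈ B = ∀ n x → A n x ≡ B n x

infix 4 _≈_

Oλs : Ctx → FVSeq → FVSeq
Oλs nil     A = A
Oλs (Σ , a) A = Oλs Σ (Oλ a A)

FV-lams : ∀ Δ M → FV (lams Δ M) ≡ Oλs Δ (FV M)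
FV-lams nil     M = refl
FV-lams (Σ , a) M = FV-lams Σ (lam a M)

Oλ-cong : ∀ a {A B} → A ≈ B → Oλ a A ≈ Oλ a B
Oλ-cong a A≈B zero    x = cong₂ (λ u v → (u ∧ not (x ≡ᵇ a)) ∨ v) (A≈B 0 x) (A≈B 1 x)
Oλ-cong a A≈B (suc n) x = A≈B (suc (suc n)) x

Oλs-cong : ∀ Δ {A B} → A ≈ B → Oλs Δ A ≈ Oλs Δ B
Oλs-cong nil     A≈B = A≈B
Oλs-cong (Σ , a) A≈B = Oλs-cong Σ (Oλ-cong a A≈B)

Oλ-shift : ∀ a B → Oλ a (Oπ B ∪ single a) ≈ B
Oλ-shift a B zero x = begin
  ((x ≡ᵇ a) ∧ not (x ≡ᵇ a)) ∨ (B 0 x ∨ false) ≡⟨ cong (_∨ (B 0 x ∨ false)) (∧-inverseʳ (x ≡ᵇ a)) ⟩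
  B 0 x ∨ false                               ≡⟨ ∨-identityʳ (B 0 x) ⟩
  B 0 x                                       ∎
Oλ-shift a B (suc n) x = ∨-identityʳ (B (suc n) x)

-- One binder: abstracting a after ⇑_{Σ,a}(s) equals ⇑_Σ(s) after abstracting a.
-- By definition O (⇑ (Σ , a) s) A = O_{π_a}(O (⇑ Σ s) (Oλ a A)) ∪ ⟨{a}, ∅, …⟩.
Oλ-⇑ : ∀ Σ a s A → Oλ a (O (⇑ (Σ , a) s) A) ≈ O (⇑ Σ s) (Oλ a A)
Oλ-⇑ Σ a s A = Oλ-shift a (O (⇑ Σ s) (Oλ a A))

O-Oλs : ∀ Δ s A → O s (Oλs Δ A) ≈ Oλs Δ (O (⇑ Δ s) A)
O-Oλs nil     s A n x = refl
O-Oλs (Σ , a) s A n x = begin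
  O s (Oλs Σ (Oλ a A)) n x                 ≡⟨ O-Oλs Σ s (Oλ a A) n x ⟩
  Oλs Σ (O (⇑ Σ s) (Oλ a A)) n x           ≡⟨ sym (Oλs-cong Σ (Oλ-⇑ Σ a s A) n x) ⟩
  Oλs Σ (Oλ a (O (⇑ (Σ , a) s) A)) n x     ∎

mainTheorem15 : (s : Subst) (Δ : Ctx) (M : Term) (n : ℕ) (x : Var) →
                FV (s ∘ₜ lams Δ M) n x ≡ FV (lams Δ (⇑ Δ s ∘ₜ M)) n x
mainTheorem15 s Δ M n x = begin
  O s (FV (lams Δ M)) n x           ≡⟨ cong (λ A → O s A n x) (FV-lams Δ M) ⟩
  O s (Oλs Δ (FV M)) n x            ≡⟨ O-Oλs Δ s (FV M) n x ⟩
  Oλs Δ (O (⇑ Δ s) (FV M)) n x      ≡⟨ cong (λ A → A n x) (sym (FV-lams Δ (⇑ Δ s ∘ₜ M))) ⟩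
  FV (lams Δ (⇑ Δ s ∘ₜ M)) n x      ∎
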